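{- Let $G$ and $H$ be two $t$-boundaried graphs with boundary $B=\{v_1,\dots,v_t\}$ (boundaries identified via labels). Then $G\equiv_{\mathrm{IS},t}H$ if and only if there exists a constant $c\in\mathbb{Z}$ such that $\mathfrak{s}_G(S)=\mathfrak{s}_H(S)+c$ for all $S\subseteq B$.
   Context: A $t$-boundaried graph is a finite simple undirected graph with an injective labeling $\lambda\colon\{1,\dots,t\}\to V$; the boundary is the set of labeled vertices, and boundaries of different $t$-boundaried graphs are identified via labels. The gluing $G\oplus F$ is obtained from the disjoint union by identifying equally labeled boundary vertices and removing parallel edges. $\mathrm{opt}_{\mathrm{IS}}$ is the maximum size of an independent set (of the underlying unboundaried graph). Two $t$-boundaried graphs $G,H$ satisfy $G\equiv_{\mathrm{IS},t}H$ if there is $\Delta\in\mathbb{Z}$ such that $\mathrm{opt}_{\mathrm{IS}}(G\oplus F)=\mathrm{opt}_{\mathrm{IS}}(H\oplus F)+\Delta$ for every $t$-boundaried graph $F$. For $S\subseteq B$, $\mathfrak{s}_G(S)$ is the maximum of $|X|$ over independent sets $X$ of $G$ with $X\cap B\subseteq S$. -}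

module Defs where

open import Data.Nat using (ℕ; zero; suc; _+_; _⊔_)
open import Data.Bool using (Bool; true; false; _∧_; _∨_; not; if_then_else_)
open import Data.Fin using (Fin; splitAt)
open import Data.Fin.Properties using (_≟_)
open import Data.Fin.Subset using (Subset; ∣_∣)
open import Data.Vec using (Vec; []; _∷_)
import Data.Vec as Vec
open import Data.List using (List; []; _∷_; allFin; filterᵇ; map; foldr; length; lookup)
open import Data.Maybe using (Maybe; just; nothing; is-nothing)
open import Data.Sum using (inj₁; inj₂)
open import Data.Product using (Σ-syntax; _×_)
open import Relation.Binary.PropositionalEquality using (_≡_)
open import Relation.Nullary.Decidable using (⌊_⌋)
open import Function.Definitions using (Injective)
open import Data.Integer using (ℤ; +_)
import Data.Integer as ℤ
import Data.Maybe

record Graph : Set where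
  field
    n   : ℕ
    adj : Fin n → Fin n → Bool

open Graph public

all : {A : Set} → (A → Bool) → List A → Bool
all p = foldr (λ x r → p x ∧ r) true

IsSimple : Graph → Set
IsSimple G = ((u v : Fin (n G)) → adj G u v ≡ adj G v u)
           × ((v : Fin (n G)) → adj G v v ≡ false)

subsets : (m : ℕ) → List (Subset m)
subsets zero    = [] ∷ []
subsets (suc m) = map (true ∷_) (subsets m) Data.List.++ map (false ∷_) (subsets m)

independent : (G : Graph) → Subset (n G) → Bool
independent G X =
  all (λ u → all (λ v → not (Vec.lookup X u ∧ Vec.lookup X v ∧ adj G u v))
                  (allFin (n G)))
      (allFin (n G))

maximum : List ℕ → ℕ
maximum = foldr _⊔_ 0

optIS : Graph → ℕ
optIS G = maximum (map ∣_∣ (filterᵇ (independent G) (subsets (n G))))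

record BGraph (t : ℕ) : Set where
  field
    graph  : Graph
    simple : IsSimple graph
    label  : Fin t → Fin (n graph)
    label-injective : Injective _≡_ _≡_ label

open BGraph public

findLabel : {t m : ℕ} → (Fin t → Fin m) → Fin m → Maybe (Fin t)
findLabel {t} λ' v =
  foldr (λ i r → if ⌊ λ' i ≟ v ⌋ then just i else r) nothing (allFin t)

inner : {t : ℕ} → (F : BGraph t) → List (Fin (n (graph F)))
inner F = filterᵇ (λ v → is-nothing (findLabel (label F) v)) (allFin (n (graph F)))

adjM : {m : ℕ} → (Fin m → Fin m → Bool) → Maybe (Fin m) → Maybe (Fin m) → Bool
adjM a (just u) (just v) = a u v
adjM a _        _        = false

-- Vertices: Fin (n G + k)
-- where the first n G are the vertices of G and the remaining k are the
-- non-boundary vertices of F.  The boundary vertex of G labelled i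
-- represents also the boundary vertex of F labelled i.  Two vertices are
-- adjacent iff they are adjacent in G or in F (parallel edges merged).
_⊕_ : {t : ℕ} → BGraph t → BGraph t → Graph
_⊕_ {t} G F = record { n = N ; adj = a }
  where
  nG = n (graph G)
  N  = nG + length (inner F)
  gRep : Fin N → Maybe (Fin nG)
  gRep w with splitAt nG w
  ... | inj₁ u = just u
  ... | inj₂ _ = nothing
  fRep : Fin N → Maybe (Fin (n (graph F)))
  fRep w with splitAt nG w
  ... | inj₁ u = Data.Maybe.map (label F) (findLabel (label G) u)
  ... | inj₂ j = just (lookup (inner F) j)
  a : Fin N → Fin N → Bool
  a u v = adjM (adj (graph G)) (gRep u) (gRep v) ∨ adjM (adj (graph F)) (fRep u) (fRep v)

_≡IS_ : {t : ℕ} → BGraph t → BGraph t → Set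
_≡IS_ {t} G H = Σ[ Δ ∈ ℤ ] ((F : BGraph t) → + optIS (G ⊕ F) ≡ + optIS (H ⊕ F) ℤ.+ Δ)

-- 𝔰_G(S) for S ⊆ B, S given as a set of labels (Subset t):
-- max |X| over independent X of G with X ∩ B ⊆ S.
respects : {t : ℕ} → (G : BGraph t) → Subset t → Subset (n (graph G)) → Bool
respects {t} G S X = all (λ i → not (Vec.lookup X (label G i)) ∨ Vec.lookup S i) (allFin t)

𝔰 : {t : ℕ} → BGraph t → Subset t → ℕ
𝔰 G S = maximum (map ∣_∣ (filterᵇ (λ X → independent (graph G) X ∧ respects G S X)
                                   (subsets (n (graph G)))))

-- An independent set of G ⊕ F is an independent set X of G together with vertices of F that
-- are compatible with the trace S of X on the boundary; the F-side only sees S. Hence X can be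
-- replaced by a largest independent set of H respecting S, and an offset c between 𝔰 G and 𝔰 H
-- bounds optIS (G ⊕ F) - optIS (H ⊕ F) by c from both sides.
-- Conversely, let F_S have one leaf per label, joined to boundary vertex i exactly when i ∉ S.
-- All leaves can be added to any independent set respecting S, and a boundary vertex outside S
-- can always be exchanged for its leaf, so optIS (G ⊕ F_S) = 𝔰 G S + t and the offset of ≡IS is
-- also an offset of 𝔰.

module Submission where

open import Defs
open import Data.Nat using (ℕ)
open import Data.Fin.Subset using (Subset)
open import Data.Product using (Σ-syntax; ∃-syntax; _,_)
open import Function.Bundles using (Equivalence; _⇔_; mk⇔)
open import Relation.Binary.PropositionalEquality

-- Natural-number addition is opened only in this block: in the theorem, _+_ is integer addition.
module _ where

  open import Data.Nat using (zero; suc; _+_; _≤_; _<_)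
  open import Data.Nat.Properties
    using ( m≤m⊔n; m≤n⊔m; ⊔-sel; ⊔-identityʳ; ≤-trans; ≤-reflexive; ≤-antisym
          ; +-monoˡ-≤; +-mono-≤; +-suc; +-cancelʳ-≡; module ≤-Reasoning; +-commutativeSemigroup)
  open import Data.Nat.Induction using (<-wellFounded)
  open import Induction.WellFounded using (Acc; acc)
  open import Algebra.Properties.CommutativeSemigroup +-commutativeSemigroup using (xy∙z≈xz∙y)
  open import Data.Bool using (Bool; true; false; _∧_; _∨_; not; if_then_else_; T)
  open import Data.Bool.Properties
    using (∧-conicalˡ; ∧-conicalʳ; ∨-conicalˡ; ∨-conicalʳ; T-≡; not-involutive; not-injective)
  open import Data.Fin using (Fin; zero; suc; splitAt; _↑ˡ_; _↑ʳ_)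
  open import Data.Fin.Properties
    using (_≟_; splitAt-↑ˡ; splitAt-↑ʳ; splitAt⁻¹-↑ˡ; splitAt⁻¹-↑ʳ; ↑ˡ-injective; ↑ʳ-injective)
  open import Data.Fin.Subset using (∣_∣; ⊥; ⊤)
  open import Data.Fin.Subset.Properties using (∣p∣≤n; ∣⊤∣≡n)
  open import Data.Vec using ([]; _∷_; _++_; lookup; _[_]≔_; tabulate)
  import Data.Vec as Vec
  import Data.Vec.Properties as Vec
  open import Data.List using (List; []; _∷_; allFin; filterᵇ; map; length)
  import Data.List as List
  open import Data.List.Membership.Propositional using (_∈_)
  open import Data.List.Membership.Propositional.Properties
    using (∈-allFin; ∈-++⁺ˡ; ∈-++⁺ʳ; ∈-map⁺; ∈-map∘filter⁺; ∈-map∘filter⁻; ∈-filter⁺; ∈-filter⁻; ∈-lookup)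
  open import Data.List.Relation.Unary.Any using (here; there; index)
  open import Data.List.Relation.Unary.Any.Properties using (lookup-index)
  open import Data.Maybe using (Maybe; just; nothing; is-nothing)
  import Data.Maybe as Maybe
  open import Data.Product using (_×_; proj₁; proj₂)
  open import Data.Sum using (_⊎_; inj₁; inj₂)
  open import Function.Base using (_∘_)
  open import Function.Definitions using (Injective)
  open import Relation.Nullary using (yes; no; contradiction)
  open import Relation.Nullary.Decidable using (T?; ⌊_⌋)

  private
    variable
      A : Set
      m : ℕ

  module _ (p : A → Bool) where

    all-≡true⁻ : ∀ {xs} → all p xs ≡ true → ∀ {x} → x ∈ xs → p x ≡ true
    all-≡true⁻ {y ∷ _} h (here refl) = ∧-conicalˡ (p y) _ h
    all-≡true⁻ {y ∷ _} h (there x∈xs) = all-≡true⁻ (∧-conicalʳ (p y) _ h) x∈xs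

    all-≡true⁺ : ∀ xs → (∀ {x} → x ∈ xs → p x ≡ true) → all p xs ≡ true
    all-≡true⁺ []       _ = refl
    all-≡true⁺ (y ∷ xs) h rewrite h (here refl) = all-≡true⁺ xs (h ∘ there)

    all-≡false⁻ : ∀ xs → all p xs ≡ false → ∃[ x ] x ∈ xs × p x ≡ false
    all-≡false⁻ (y ∷ xs) h with p y in py
    ... | false = y , here refl , py
    ... | true  with all-≡false⁻ xs h
    ...   | x , x∈xs , px = x , there x∈xs , px

  subsets-complete : ∀ m (X : Subset m) → X ∈ subsets m
  subsets-complete zero    []          = here refl
  subsets-complete (suc m) (true ∷ X)  = ∈-++⁺ˡ (∈-map⁺ (true ∷_) (subsets-complete m X))
  subsets-complete (suc m) (false ∷ X) =
    ∈-++⁺ʳ (map (true ∷_) (subsets m)) (∈-map⁺ (false ∷_) (subsets-complete m X))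

  ≤maximum : ∀ {k ns} → k ∈ ns → k ≤ maximum ns
  ≤maximum {ns = k ∷ ns} (here refl)  = m≤m⊔n k (maximum ns)
  ≤maximum {ns = l ∷ ns} (there k∈ns) = ≤-trans (≤maximum k∈ns) (m≤n⊔m l (maximum ns))

  maximum-∈ : ∀ {k ns} → k ∈ ns → maximum ns ∈ ns
  maximum-∈ {ns = l ∷ ns} _ = maximum-∈-∷ l ns
    where
    maximum-∈-∷ : ∀ l ns → maximum (l ∷ ns) ∈ l ∷ ns
    maximum-∈-∷ l []        = here (⊔-identityʳ l)
    maximum-∈-∷ l (l′ ∷ ns) with ⊔-sel l (maximum (l′ ∷ ns))
    ... | inj₁ eq = here eq
    ... | inj₂ eq = there (subst (_∈ l′ ∷ ns) (sym eq) (maximum-∈-∷ l′ ns))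

  maxCard : (Subset m → Bool) → ℕ
  maxCard {m} p = maximum (map ∣_∣ (filterᵇ p (subsets m)))

  module _ (p : Subset m → Bool) where

    private
      ∣X∣∈sizes : ∀ X → p X ≡ true → ∣ X ∣ ∈ map ∣_∣ (filterᵇ p (subsets m))
      ∣X∣∈sizes X pX = ∈-map∘filter⁺ ∣_∣ (T? ∘ p) {xs = subsets m}
        (X , subsets-complete m X , refl , Equivalence.from T-≡ pX)

    ≤maxCard : ∀ X → p X ≡ true → ∣ X ∣ ≤ maxCard p
    ≤maxCard X pX = ≤maximum (∣X∣∈sizes X pX)

    maxCard-attained : ∀ X → p X ≡ true → ∃[ Y ] p Y ≡ true × ∣ Y ∣ ≡ maxCard p
    maxCard-attained X pX
      with ∈-map∘filter⁻ ∣_∣ (T? ∘ p) {xs = subsets m} (maximum-∈ (∣X∣∈sizes X pX))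
    ... | Y , _ , max≡∣Y∣ , pY = Y , Equivalence.to T-≡ pY , sym max≡∣Y∣

  ∣++∣ : ∀ {k l} (X : Subset k) (Y : Subset l) → ∣ X ++ Y ∣ ≡ ∣ X ∣ + ∣ Y ∣
  ∣++∣ []          Y = refl
  ∣++∣ (true ∷ X)  Y = cong suc (∣++∣ X Y)
  ∣++∣ (false ∷ X) Y = ∣++∣ X Y

  ∣[]≔false∣ : ∀ (X : Subset m) u → lookup X u ≡ true → suc ∣ X [ u ]≔ false ∣ ≡ ∣ X ∣
  ∣[]≔false∣ (true  ∷ X) zero    _   = refl
  ∣[]≔false∣ (true  ∷ X) (suc u) u∈X = cong suc (∣[]≔false∣ X u u∈X)
  ∣[]≔false∣ (false ∷ X) (suc u) u∈X = ∣[]≔false∣ X u u∈X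

  ∣[]≔true∣ : ∀ (X : Subset m) u → lookup X u ≡ false → ∣ X [ u ]≔ true ∣ ≡ suc ∣ X ∣
  ∣[]≔true∣ (false ∷ X) zero    _   = refl
  ∣[]≔true∣ (true  ∷ X) (suc u) u∉X = cong suc (∣[]≔true∣ X u u∉X)
  ∣[]≔true∣ (false ∷ X) (suc u) u∉X = ∣[]≔true∣ X u u∉X

  lookup-[]≔false⁻ : ∀ (X : Subset m) u v → lookup (X [ u ]≔ false) v ≡ true → lookup X v ≡ true
  lookup-[]≔false⁻ X u v v∈X′ with u ≟ v
  ... | yes refl = contradiction (trans (sym (Vec.lookup∘update u X false)) v∈X′) λ ()
  ... | no u≢v   = trans (sym (Vec.lookup∘update′ (u≢v ∘ sym) X false)) v∈X′

  module _ (G : Graph) where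

    independent⁻ : ∀ X → independent G X ≡ true →
                   ∀ u v → lookup X u ≡ true → lookup X v ≡ true → adj G u v ≡ false
    independent⁻ X indep u v u∈X v∈X
      with all-≡true⁻ _ (all-≡true⁻ _ indep (∈-allFin u)) (∈-allFin v)
    ... | no-edge rewrite u∈X | v∈X = trans (sym (not-involutive (adj G u v))) (cong not no-edge)

    independent⁺ : ∀ X → (∀ u v → lookup X u ≡ true → lookup X v ≡ true → adj G u v ≡ false) →
                   independent G X ≡ true
    independent⁺ X h =
      all-≡true⁺ _ (allFin (n G)) λ {u} _ → all-≡true⁺ _ (allFin (n G)) λ {v} _ → no-edge u v
      where
      no-edge : ∀ u v → not (lookup X u ∧ lookup X v ∧ adj G u v) ≡ true
      no-edge u v with lookup X u in u∈X | lookup X v in v∈X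
      ... | false | _     = refl
      ... | true  | false = refl
      ... | true  | true  rewrite h u v u∈X v∈X = refl

    independent-⊥ : independent G ⊥ ≡ true
    independent-⊥ = independent⁺ ⊥ λ u _ u∈⊥ _ →
      contradiction (trans (sym (Vec.lookup-replicate u false)) u∈⊥) λ ()

    independent-[]≔false : ∀ X u → independent G X ≡ true → independent G (X [ u ]≔ false) ≡ true
    independent-[]≔false X u indep = independent⁺ (X [ u ]≔ false) λ v w v∈X′ w∈X′ →
      independent⁻ X indep v w (lookup-[]≔false⁻ X u v v∈X′) (lookup-[]≔false⁻ X u w w∈X′)

  module _ {t} (G : BGraph t) (S : Subset t) where

    respects⁻ : ∀ X → respects G S X ≡ true →
                ∀ i → lookup X (label G i) ≡ true → lookup S i ≡ true
    respects⁻ X resp i i∈X with all-≡true⁻ _ resp (∈-allFin i)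
    ... | allowed rewrite i∈X = allowed

    respects⁺ : ∀ X → (∀ i → lookup X (label G i) ≡ true → lookup S i ≡ true) →
                respects G S X ≡ true
    respects⁺ X h = all-≡true⁺ _ (allFin t) λ {i} _ → allowed i
      where
      allowed : ∀ i → not (lookup X (label G i)) ∨ lookup S i ≡ true
      allowed i with lookup X (label G i) in i∈X
      ... | false = refl
      ... | true  = h i i∈X

    respects-≡false⁻ : ∀ X → respects G S X ≡ false →
                       ∃[ i ] lookup X (label G i) ≡ true × lookup S i ≡ false
    respects-≡false⁻ X resp with all-≡false⁻ _ (allFin t) resp
    ... | i , _ , violated =
      i , not-injective (∨-conicalˡ _ _ violated) , ∨-conicalʳ _ _ violated

    respects-⊥ : respects G S ⊥ ≡ true
    respects-⊥ = respects⁺ ⊥ λ i i∈⊥ →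
      contradiction (trans (sym (Vec.lookup-replicate (label G i) false)) i∈⊥) λ ()

  ≤optIS : ∀ G X → independent G X ≡ true → ∣ X ∣ ≤ optIS G
  ≤optIS G = ≤maxCard (independent G)

  optIS-attained : ∀ G → ∃[ X ] independent G X ≡ true × ∣ X ∣ ≡ optIS G
  optIS-attained G = maxCard-attained (independent G) ⊥ (independent-⊥ G)

  module _ {t} (G : BGraph t) (S : Subset t) where

    ≤𝔰 : ∀ X → independent (graph G) X ≡ true → respects G S X ≡ true → ∣ X ∣ ≤ 𝔰 G S
    ≤𝔰 X indep resp = ≤maxCard _ X (trans (cong (_∧ respects G S X) indep) resp)

    𝔰-attained : ∃[ X ] independent (graph G) X ≡ true × respects G S X ≡ true × ∣ X ∣ ≡ 𝔰 G S
    𝔰-attained with maxCard-attained _ ⊥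
      (trans (cong (_∧ respects G S ⊥) (independent-⊥ (graph G))) (respects-⊥ G S))
    ... | X , indep∧resp , ∣X∣≡𝔰 = X , ∧-conicalˡ _ _ indep∧resp , ∧-conicalʳ _ _ indep∧resp , ∣X∣≡𝔰

  module _ {t m} (ℓ : Fin t → Fin m) (v : Fin m) where

    private
      findIn : List (Fin t) → Maybe (Fin t)
      findIn = List.foldr (λ i r → if ⌊ ℓ i ≟ v ⌋ then just i else r) nothing

      findIn-just⁻ : ∀ xs {i} → findIn xs ≡ just i → ℓ i ≡ v
      findIn-just⁻ (x ∷ xs) found with ℓ x ≟ v
      findIn-just⁻ (x ∷ xs) refl  | yes ℓx≡v = ℓx≡v
      ... | no _ = findIn-just⁻ xs found

      findIn-nothing⁻ : ∀ xs → findIn xs ≡ nothing → ∀ {i} → i ∈ xs → ℓ i ≢ v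
      findIn-nothing⁻ (x ∷ xs) missing i∈xs with ℓ x ≟ v
      findIn-nothing⁻ (x ∷ xs) ()      _            | yes _
      findIn-nothing⁻ (x ∷ xs) missing (here refl)  | no ℓx≢v = ℓx≢v
      findIn-nothing⁻ (x ∷ xs) missing (there i∈xs) | no _    = findIn-nothing⁻ xs missing i∈xs

    findLabel-just⁻ : ∀ {i} → findLabel ℓ v ≡ just i → ℓ i ≡ v
    findLabel-just⁻ = findIn-just⁻ (allFin t)

    findLabel-nothing⁻ : findLabel ℓ v ≡ nothing → ∀ i → ℓ i ≢ v
    findLabel-nothing⁻ missing i = findIn-nothing⁻ (allFin t) missing (∈-allFin i)

  findLabel-label : ∀ {t m} {ℓ : Fin t → Fin m} → Injective _≡_ _≡_ ℓ →
                    ∀ i → findLabel ℓ (ℓ i) ≡ just i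
  findLabel-label {ℓ = ℓ} ℓ-injective i with findLabel ℓ (ℓ i) in found
  ... | just j  = cong just (ℓ-injective (findLabel-just⁻ ℓ (ℓ i) found))
  ... | nothing = contradiction refl (findLabel-nothing⁻ ℓ (ℓ i) found i)

  innerVertex : ∀ {t} (F : BGraph t) → Fin (length (inner F)) → Fin (n (graph F))
  innerVertex F = List.lookup (inner F)

  trace : ∀ {t} (G : BGraph t) → Subset (n (graph G)) → Subset t
  trace G X = tabulate (λ i → lookup X (label G i))

  lookup-trace : ∀ {t} (G : BGraph t) X i → lookup (trace G X) i ≡ lookup X (label G i)
  lookup-trace G X = Vec.lookup∘tabulate (λ i → lookup X (label G i))

  respects-trace : ∀ {t} (G : BGraph t) X → respects G (trace G X) X ≡ true
  respects-trace G X = respects⁺ G (trace G X) X λ i i∈X → trans (lookup-trace G X i) i∈X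

  -- The boundary vertices of F with labels in S, together with Xin, form an independent set of F.
  record Compatible {t} (F : BGraph t) (S : Subset t) (Xin : Subset (length (inner F))) : Set where
    field
      boundary : ∀ i i′ → lookup S i ≡ true → lookup S i′ ≡ true →
                 adj (graph F) (label F i) (label F i′) ≡ false
      crossing : ∀ i j → lookup S i ≡ true → lookup Xin j ≡ true →
                 adj (graph F) (label F i) (innerVertex F j) ≡ false
      interior : ∀ j j′ → lookup Xin j ≡ true → lookup Xin j′ ≡ true →
                 adj (graph F) (innerVertex F j) (innerVertex F j′) ≡ false

  Compatible-antitone : ∀ {t} {F : BGraph t} {S T Xin} →
    (∀ i → lookup T i ≡ true → lookup S i ≡ true) → Compatible F S Xin → Compatible F T Xin
  Compatible-antitone T⊆S compatible = record
    { boundary = λ i i′ i∈T i′∈T → boundary i i′ (T⊆S i i∈T) (T⊆S i′ i′∈T)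
    ; crossing = λ i j i∈T → crossing i j (T⊆S i i∈T)
    ; interior = interior
    }
    where open Compatible compatible

  module Gluing {t} (G F : BGraph t) where

    private
      nG k : ℕ
      nG = n (graph G)
      k  = length (inner F)

    image : Fin nG → Maybe (Fin (n (graph F)))
    image u = Maybe.map (label F) (findLabel (label G) u)

    image-label : ∀ i → image (label G i) ≡ just (label F i)
    image-label i rewrite findLabel-label (label-injective G) i = refl

    image-just⁻ : ∀ u {w} → image u ≡ just w → ∃[ i ] label G i ≡ u × label F i ≡ w
    image-just⁻ u found with findLabel (label G) u in labelled
    image-just⁻ u refl | just i = i , findLabel-just⁻ (label G) u labelled , refl

    data GluedVertex : Fin (nG + k) → Set where
      fromG : ∀ u → GluedVertex (u ↑ˡ k)
      fromF : ∀ j → GluedVertex (nG ↑ʳ j)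

    gluedVertex : ∀ w → GluedVertex w
    gluedVertex w with splitAt nG w in split
    ... | inj₁ u = subst GluedVertex (splitAt⁻¹-↑ˡ split) (fromG u)
    ... | inj₂ j = subst GluedVertex (splitAt⁻¹-↑ʳ split) (fromF j)

    adj-GG : ∀ u v → adj (G ⊕ F) (u ↑ˡ k) (v ↑ˡ k) ≡
                     (adj (graph G) u v ∨ adjM (adj (graph F)) (image u) (image v))
    adj-GG u v rewrite splitAt-↑ˡ nG u k | splitAt-↑ˡ nG v k = refl

    adj-GF : ∀ u j → adj (G ⊕ F) (u ↑ˡ k) (nG ↑ʳ j) ≡
                     adjM (adj (graph F)) (image u) (just (innerVertex F j))
    adj-GF u j rewrite splitAt-↑ˡ nG u k | splitAt-↑ʳ nG k j = refl

    adj-FG : ∀ j u → adj (G ⊕ F) (nG ↑ʳ j) (u ↑ˡ k) ≡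
                     adjM (adj (graph F)) (just (innerVertex F j)) (image u)
    adj-FG j u rewrite splitAt-↑ˡ nG u k | splitAt-↑ʳ nG k j = refl

    adj-FF : ∀ j j′ → adj (G ⊕ F) (nG ↑ʳ j) (nG ↑ʳ j′) ≡
                      adj (graph F) (innerVertex F j) (innerVertex F j′)
    adj-FF j j′ rewrite splitAt-↑ʳ nG k j | splitAt-↑ʳ nG k j′ = refl

    module _ (XG : Subset nG) (Xin : Subset k) where

      private
        ∈G⁺ : ∀ {u} → lookup XG u ≡ true → lookup (XG ++ Xin) (u ↑ˡ k) ≡ true
        ∈G⁺ {u} = trans (Vec.lookup-++ˡ XG Xin u)

        ∈F⁺ : ∀ {j} → lookup Xin j ≡ true → lookup (XG ++ Xin) (nG ↑ʳ j) ≡ true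
        ∈F⁺ {j} = trans (Vec.lookup-++ʳ XG Xin j)

        ∈G⁻ : ∀ {u} → lookup (XG ++ Xin) (u ↑ˡ k) ≡ true → lookup XG u ≡ true
        ∈G⁻ {u} = trans (sym (Vec.lookup-++ˡ XG Xin u))

        ∈F⁻ : ∀ {j} → lookup (XG ++ Xin) (nG ↑ʳ j) ≡ true → lookup Xin j ≡ true
        ∈F⁻ {j} = trans (sym (Vec.lookup-++ʳ XG Xin j))

        ∈trace⁺ : ∀ {i} → lookup XG (label G i) ≡ true → lookup (trace G XG) i ≡ true
        ∈trace⁺ {i} = trans (lookup-trace G XG i)

        ∈trace⁻ : ∀ {i} → lookup (trace G XG) i ≡ true → lookup XG (label G i) ≡ true
        ∈trace⁻ {i} = trans (sym (lookup-trace G XG i))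

      glued-independent⁺ : independent (graph G) XG ≡ true → Compatible F (trace G XG) Xin →
                           independent (G ⊕ F) (XG ++ Xin) ≡ true
      glued-independent⁺ indep compatible =
        independent⁺ (G ⊕ F) (XG ++ Xin) λ w w′ → no-edge (gluedVertex w) (gluedVertex w′)
        where
        open Compatible compatible

        image-no-edge : ∀ u v → lookup XG u ≡ true → lookup XG v ≡ true →
                        adjM (adj (graph F)) (image u) (image v) ≡ false
        image-no-edge u v u∈XG v∈XG with image u in image-u | image v in image-v
        ... | nothing | _       = refl
        ... | just _  | nothing = refl
        ... | just _  | just _  with image-just⁻ u image-u | image-just⁻ v image-v
        ...   | i , refl , refl | i′ , refl , refl = boundary i i′ (∈trace⁺ u∈XG) (∈trace⁺ v∈XG)

        crossing-no-edge : ∀ u j → lookup XG u ≡ true → lookup Xin j ≡ true →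
                           adjM (adj (graph F)) (image u) (just (innerVertex F j)) ≡ false
        crossing-no-edge u j u∈XG j∈Xin with image u in image-u
        ... | nothing = refl
        ... | just _  with image-just⁻ u image-u
        ...   | i , refl , refl = crossing i j (∈trace⁺ u∈XG) j∈Xin

        no-edge : ∀ {w w′} → GluedVertex w → GluedVertex w′ →
                  lookup (XG ++ Xin) w ≡ true → lookup (XG ++ Xin) w′ ≡ true → adj (G ⊕ F) w w′ ≡ false
        no-edge (fromG u) (fromG v) u∈X v∈X = trans (adj-GG u v)
          (cong₂ _∨_ (independent⁻ (graph G) XG indep u v (∈G⁻ u∈X) (∈G⁻ v∈X))
                     (image-no-edge u v (∈G⁻ u∈X) (∈G⁻ v∈X)))
        no-edge (fromG u) (fromF j) u∈X j∈X = trans (adj-GF u j) (crossing-no-edge u j (∈G⁻ u∈X) (∈F⁻ j∈X))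
        no-edge (fromF j) (fromG u) j∈X u∈X = trans (adj-FG j u)
          (trans (adjM-sym (image u)) (crossing-no-edge u j (∈G⁻ u∈X) (∈F⁻ j∈X)))
          where
          adjM-sym : ∀ m → adjM (adj (graph F)) (just (innerVertex F j)) m ≡
                           adjM (adj (graph F)) m (just (innerVertex F j))
          adjM-sym nothing  = refl
          adjM-sym (just x) = proj₁ (simple F) (innerVertex F j) x
        no-edge (fromF j) (fromF j′) j∈X j′∈X = trans (adj-FF j j′) (interior j j′ (∈F⁻ j∈X) (∈F⁻ j′∈X))

      glued-independent⁻ : independent (G ⊕ F) (XG ++ Xin) ≡ true →
                           independent (graph G) XG ≡ true × Compatible F (trace G XG) Xin
      glued-independent⁻ indep = independent⁺ (graph G) XG in-G , record
        { boundary = λ i i′ i∈S i′∈S →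
            subst₂ (λ a b → adjM (adj (graph F)) a b ≡ false) (image-label i) (image-label i′)
              (∨-conicalʳ _ _ (G-edge (label G i) (label G i′) (∈trace⁻ i∈S) (∈trace⁻ i′∈S)))
        ; crossing = λ i j i∈S j∈Xin →
            subst (λ a → adjM (adj (graph F)) a (just (innerVertex F j)) ≡ false) (image-label i)
              (trans (sym (adj-GF (label G i) j))
                     (glued-edge (label G i ↑ˡ k) (nG ↑ʳ j) (∈G⁺ (∈trace⁻ i∈S)) (∈F⁺ j∈Xin)))
        ; interior = λ j j′ j∈Xin j′∈Xin →
            trans (sym (adj-FF j j′)) (glued-edge (nG ↑ʳ j) (nG ↑ʳ j′) (∈F⁺ j∈Xin) (∈F⁺ j′∈Xin))
        }
        where
        glued-edge : ∀ w w′ → lookup (XG ++ Xin) w ≡ true → lookup (XG ++ Xin) w′ ≡ true →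
                     adj (G ⊕ F) w w′ ≡ false
        glued-edge = independent⁻ (G ⊕ F) (XG ++ Xin) indep

        G-edge : ∀ u v → lookup XG u ≡ true → lookup XG v ≡ true →
                 (adj (graph G) u v ∨ adjM (adj (graph F)) (image u) (image v)) ≡ false
        G-edge u v u∈XG v∈XG =
          trans (sym (adj-GG u v)) (glued-edge (u ↑ˡ k) (v ↑ˡ k) (∈G⁺ u∈XG) (∈G⁺ v∈XG))

        in-G : ∀ u v → lookup XG u ≡ true → lookup XG v ≡ true → adj (graph G) u v ≡ false
        in-G u v u∈XG v∈XG = ∨-conicalˡ _ _ (G-edge u v u∈XG v∈XG)

  module _ {t} (G F : BGraph t) where

    private
      nG : ℕ
      nG = n (graph G)

    ≤optIS-⊕ : ∀ XG Xin → independent (graph G) XG ≡ true → Compatible F (trace G XG) Xin →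
               ∣ XG ∣ + ∣ Xin ∣ ≤ optIS (G ⊕ F)
    ≤optIS-⊕ XG Xin indep compatible = subst (_≤ optIS (G ⊕ F)) (∣++∣ XG Xin)
      (≤optIS (G ⊕ F) (XG ++ Xin) (Gluing.glued-independent⁺ G F XG Xin indep compatible))

    optIS-⊕-attained : ∃[ XG ] ∃[ Xin ] independent (graph G) XG ≡ true ×
                                        Compatible F (trace G XG) Xin × ∣ XG ∣ + ∣ Xin ∣ ≡ optIS (G ⊕ F)
    optIS-⊕-attained with optIS-attained (G ⊕ F)
    ... | X , indep , ∣X∣≡opt with Vec.splitAt nG X
    ...   | XG , Xin , refl with Gluing.glued-independent⁻ G F XG Xin indep
    ...     | indepG , compatible = XG , Xin , indepG , compatible , trans (sym (∣++∣ XG Xin)) ∣X∣≡opt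

  optIS-⊕-mono : ∀ {t} (G H F : BGraph t) {d e} → (∀ S → 𝔰 G S + d ≤ 𝔰 H S + e) →
                 optIS (G ⊕ F) + d ≤ optIS (H ⊕ F) + e
  optIS-⊕-mono G H F {d} {e} 𝔰G≤𝔰H with optIS-⊕-attained G F
  ... | XG , Xin , indepG , compatible , ∣X∣≡opt with 𝔰-attained H (trace G XG)
  ... | Y , indepY , respY , ∣Y∣≡𝔰 = begin
    optIS (G ⊕ F) + d        ≡⟨ cong (_+ d) (sym ∣X∣≡opt) ⟩
    ∣ XG ∣ + ∣ Xin ∣ + d     ≡⟨ xy∙z≈xz∙y ∣ XG ∣ ∣ Xin ∣ d ⟩
    ∣ XG ∣ + d + ∣ Xin ∣     ≤⟨ +-monoˡ-≤ ∣ Xin ∣ (+-monoˡ-≤ d (≤𝔰 G S XG indepG (respects-trace G XG))) ⟩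
    𝔰 G S + d + ∣ Xin ∣      ≤⟨ +-monoˡ-≤ ∣ Xin ∣ (𝔰G≤𝔰H S) ⟩
    𝔰 H S + e + ∣ Xin ∣      ≡⟨ xy∙z≈xz∙y (𝔰 H S) e ∣ Xin ∣ ⟩
    𝔰 H S + ∣ Xin ∣ + e      ≡⟨ cong (λ s → s + ∣ Xin ∣ + e) (sym ∣Y∣≡𝔰) ⟩
    ∣ Y ∣ + ∣ Xin ∣ + e      ≤⟨ +-monoˡ-≤ e (≤optIS-⊕ H F Y Xin indepY compatibleY) ⟩
    optIS (H ⊕ F) + e        ∎
    where
    open ≤-Reasoning
    S : Subset _
    S = trace G XG

    compatibleY : Compatible F (trace H Y) Xin
    compatibleY = Compatible-antitone
      (λ i i∈trace → respects⁻ H S Y respY i (trans (sym (lookup-trace H Y i)) i∈trace)) compatible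

  optIS-⊕-shift : ∀ {t} (G H : BGraph t) {d e} → (∀ S → 𝔰 G S + e ≡ 𝔰 H S + d) →
                  ∀ F → optIS (G ⊕ F) + e ≡ optIS (H ⊕ F) + d
  optIS-⊕-shift G H 𝔰-shift F = ≤-antisym
    (optIS-⊕-mono G H F (≤-reflexive ∘ 𝔰-shift))
    (optIS-⊕-mono H G F (≤-reflexive ∘ sym ∘ 𝔰-shift))

  ↑ˡ≢↑ʳ : ∀ {m n} (i : Fin m) (l : Fin n) → i ↑ˡ n ≢ m ↑ʳ l
  ↑ˡ≢↑ʳ {m} {n} i l eq
    with trans (sym (splitAt-↑ˡ m i n)) (trans (cong (splitAt m) eq) (splitAt-↑ʳ m n l))
  ... | ()

  -- Boundary vertex i ↑ˡ t carries label i; leaf t ↑ʳ i is attached to it exactly when i ∉ S.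
  gadgetAdj : ∀ {t} → Subset t → Fin t ⊎ Fin t → Fin t ⊎ Fin t → Bool
  gadgetAdj S (inj₁ i) (inj₂ l) = ⌊ i ≟ l ⌋ ∧ not (lookup S i)
  gadgetAdj S (inj₂ l) (inj₁ i) = ⌊ i ≟ l ⌋ ∧ not (lookup S i)
  gadgetAdj S _        _        = false

  gadgetGraph : ∀ {t} → Subset t → Graph
  gadgetGraph {t} S = record { n = t + t ; adj = λ v w → gadgetAdj S (splitAt t v) (splitAt t w) }

  gadgetGraph-simple : ∀ {t} (S : Subset t) → IsSimple (gadgetGraph S)
  gadgetGraph-simple {t} S = (λ v w → symmetric (splitAt t v) (splitAt t w)) , irreflexive ∘ splitAt t
    where
    symmetric : ∀ x y → gadgetAdj S x y ≡ gadgetAdj S y x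
    symmetric (inj₁ _) (inj₁ _) = refl
    symmetric (inj₁ _) (inj₂ _) = refl
    symmetric (inj₂ _) (inj₁ _) = refl
    symmetric (inj₂ _) (inj₂ _) = refl

    irreflexive : ∀ x → gadgetAdj S x x ≡ false
    irreflexive (inj₁ _) = refl
    irreflexive (inj₂ _) = refl

  gadget : ∀ {t} → Subset t → BGraph t
  gadget {t} S = record
    { graph           = gadgetGraph S
    ; simple          = gadgetGraph-simple S
    ; label           = _↑ˡ t
    ; label-injective = ↑ˡ-injective t _ _
    }

  module Gadget {t} (S : Subset t) where

    private
      F : BGraph t
      F = gadget S

    innerVertex-leaf : ∀ j → ∃[ l ] innerVertex F j ≡ t ↑ʳ l
    innerVertex-leaf j with splitAt t (innerVertex F j) in split
    ... | inj₂ l = l , sym (splitAt⁻¹-↑ʳ split)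
    ... | inj₁ i =
      contradiction (splitAt⁻¹-↑ˡ split) (findLabel-nothing⁻ (label F) (innerVertex F j) unlabelled i)
      where
      unlabelled : findLabel (label F) (innerVertex F j) ≡ nothing
      unlabelled with findLabel (label F) (innerVertex F j)
                    | proj₂ (∈-filter⁻ (T? ∘ is-nothing ∘ findLabel (label F)) {xs = allFin (t + t)}
                                       (∈-lookup {xs = inner F} j))
      ... | nothing | _  = refl
      ... | just _  | ()

    leaf-innerVertex : ∀ l → ∃[ j ] innerVertex F j ≡ t ↑ʳ l
    leaf-innerVertex l = index leaf∈inner , sym (lookup-index leaf∈inner)
      where
      unlabelled : T (is-nothing (findLabel (label F) (t ↑ʳ l)))
      unlabelled with findLabel (label F) (t ↑ʳ l) in found
      ... | nothing = _
      ... | just i  = ↑ˡ≢↑ʳ i l (findLabel-just⁻ (label F) (t ↑ʳ l) found)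

      leaf∈inner : t ↑ʳ l ∈ inner F
      leaf∈inner = ∈-filter⁺ (T? ∘ is-nothing ∘ findLabel (label F)) (∈-allFin (t ↑ʳ l)) unlabelled

    adj-boundary-boundary : ∀ i i′ → adj (graph F) (label F i) (label F i′) ≡ false
    adj-boundary-boundary i i′ rewrite splitAt-↑ˡ t i t | splitAt-↑ˡ t i′ t = refl

    adj-boundary-leaf : ∀ i l → adj (graph F) (label F i) (t ↑ʳ l) ≡ ⌊ i ≟ l ⌋ ∧ not (lookup S i)
    adj-boundary-leaf i l rewrite splitAt-↑ˡ t i t | splitAt-↑ʳ t t l = refl

    adj-leaf-leaf : ∀ l l′ → adj (graph F) (t ↑ʳ l) (t ↑ʳ l′) ≡ false
    adj-leaf-leaf l l′ rewrite splitAt-↑ʳ t t l | splitAt-↑ʳ t t l′ = refl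

    LeavesAvoided : Subset t → Subset (length (inner F)) → Set
    LeavesAvoided T Xin = ∀ i j → lookup T i ≡ true → lookup S i ≡ false →
                          innerVertex F j ≡ t ↑ʳ i → lookup Xin j ≡ false

    compatible⁺ : ∀ {T Xin} → LeavesAvoided T Xin → Compatible F T Xin
    compatible⁺ {T} {Xin} avoided = record
      { boundary = λ i i′ _ _ → adj-boundary-boundary i i′
      ; crossing = crossing
      ; interior = interior
      }
      where
      crossing : ∀ i j → lookup T i ≡ true → lookup Xin j ≡ true →
                 adj (graph F) (label F i) (innerVertex F j) ≡ false
      crossing i j i∈T j∈Xin with innerVertex-leaf j
      ... | l , leaf rewrite leaf | adj-boundary-leaf i l with i ≟ l
      ...   | no _     = refl
      ...   | yes refl with lookup S i in i∈S
      ...     | true  = refl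
      ...     | false = contradiction (trans (sym j∈Xin) (avoided i j i∈T i∈S leaf)) λ ()

      interior : ∀ j j′ → lookup Xin j ≡ true → lookup Xin j′ ≡ true →
                 adj (graph F) (innerVertex F j) (innerVertex F j′) ≡ false
      interior j j′ _ _ with innerVertex-leaf j | innerVertex-leaf j′
      ... | l , leaf | l′ , leaf′ rewrite leaf | leaf′ = adj-leaf-leaf l l′

    compatible⁻ : ∀ {T Xin} → Compatible F T Xin → LeavesAvoided T Xin
    compatible⁻ {Xin = Xin} compatible i j i∈T i∉S leaf with lookup Xin j in j∈Xin
    ... | false = refl
    ... | true  = contradiction (trans (sym attached) (Compatible.crossing compatible i j i∈T j∈Xin)) λ ()
      where
      attached : adj (graph F) (label F i) (innerVertex F j) ≡ true
      attached rewrite leaf | adj-boundary-leaf i i | i∉S with i ≟ i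
      ... | yes _   = refl
      ... | no i≢i = contradiction refl i≢i

  module _ {t} (G : BGraph t) (S : Subset t) where

    open Gadget S

    private
      F : BGraph t
      F = gadget S

      k : ℕ
      k = length (inner F)

    𝔰+k≤optIS-gadget : 𝔰 G S + k ≤ optIS (G ⊕ F)
    𝔰+k≤optIS-gadget with 𝔰-attained G S
    ... | Y , indep , resp , ∣Y∣≡𝔰 =
      subst (_≤ optIS (G ⊕ F)) (cong₂ _+_ ∣Y∣≡𝔰 (∣⊤∣≡n k))
        (≤optIS-⊕ G F Y ⊤ indep (compatible⁺ avoided))
      where
      avoided : LeavesAvoided (trace G Y) ⊤
      avoided i _ i∈Y i∉S _ =
        contradiction (trans (sym (respects⁻ G S Y resp i (trans (sym (lookup-trace G Y i)) i∈Y))) i∉S) λ ()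

    -- A vertex of G on the boundary outside S is traded for the leaf that its presence excluded.
    exchange : ∀ XG Xin {i} → independent (graph G) XG ≡ true → Compatible F (trace G XG) Xin →
               lookup XG (label G i) ≡ true → lookup S i ≡ false →
               ∃[ XG′ ] ∃[ Xin′ ] independent (graph G) XG′ ≡ true × Compatible F (trace G XG′) Xin′ ×
                                  suc ∣ XG′ ∣ ≡ ∣ XG ∣ × ∣ Xin′ ∣ ≡ suc ∣ Xin ∣
    exchange XG Xin {i} indep compatible i∈XG i∉S with leaf-innerVertex i
    ... | j , leaf =
      XG′ , Xin [ j ]≔ true , independent-[]≔false (graph G) XG u indep , compatible⁺ avoided ,
      ∣[]≔false∣ XG u i∈XG , ∣[]≔true∣ Xin j j∉Xin
      where
      u : Fin (n (graph G))
      u = label G i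

      XG′ : Subset (n (graph G))
      XG′ = XG [ u ]≔ false

      j∉Xin : lookup Xin j ≡ false
      j∉Xin = compatible⁻ compatible i j (trans (lookup-trace G XG i) i∈XG) i∉S leaf

      avoided : LeavesAvoided (trace G XG′) (Xin [ j ]≔ true)
      avoided i′ j′ i′∈XG′ i′∉S leaf′ with j ≟ j′
      ... | yes refl with ↑ʳ-injective t i i′ (trans (sym leaf) leaf′)
      ...   | refl = contradiction
        (trans (sym (Vec.lookup∘update u XG false)) (trans (sym (lookup-trace G XG′ i)) i′∈XG′)) λ ()
      avoided i′ j′ i′∈XG′ i′∉S leaf′ | no j≢j′ =
        trans (Vec.lookup∘update′ (j≢j′ ∘ sym) Xin true) (compatible⁻ compatible i′ j′ i′∈XG i′∉S leaf′)
        where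
        i′∈XG : lookup (trace G XG) i′ ≡ true
        i′∈XG = trans (lookup-trace G XG i′)
          (lookup-[]≔false⁻ XG u (label G i′) (trans (sym (lookup-trace G XG′ i′)) i′∈XG′))

    compatible-bound : ∀ XG Xin → Acc _<_ ∣ XG ∣ →
                       independent (graph G) XG ≡ true → Compatible F (trace G XG) Xin →
                       ∣ XG ∣ + ∣ Xin ∣ ≤ 𝔰 G S + k
    compatible-bound XG Xin (acc smaller) indep compatible with respects G S XG in resp
    ... | true  = +-mono-≤ (≤𝔰 G S XG indep resp) (∣p∣≤n Xin)
    ... | false with respects-≡false⁻ G S XG resp
    ...   | i , i∈XG , i∉S with exchange XG Xin indep compatible i∈XG i∉S
    ...     | XG′ , Xin′ , indep′ , compatible′ , shrink , grow =
      subst (_≤ 𝔰 G S + k) same-size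
        (compatible-bound XG′ Xin′ (smaller (≤-reflexive shrink)) indep′ compatible′)
      where
      same-size : ∣ XG′ ∣ + ∣ Xin′ ∣ ≡ ∣ XG ∣ + ∣ Xin ∣
      same-size = begin
        ∣ XG′ ∣ + ∣ Xin′ ∣      ≡⟨ cong (∣ XG′ ∣ +_) grow ⟩
        ∣ XG′ ∣ + suc ∣ Xin ∣   ≡⟨ +-suc ∣ XG′ ∣ ∣ Xin ∣ ⟩
        suc ∣ XG′ ∣ + ∣ Xin ∣   ≡⟨ cong (_+ ∣ Xin ∣) shrink ⟩
        ∣ XG ∣ + ∣ Xin ∣        ∎
        where open ≡-Reasoning

    optIS-gadget : optIS (G ⊕ F) ≡ 𝔰 G S + k
    optIS-gadget with optIS-⊕-attained G F
    ... | XG , Xin , indep , compatible , ∣X∣≡opt = ≤-antisym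
      (subst (_≤ 𝔰 G S + k) ∣X∣≡opt (compatible-bound XG Xin (<-wellFounded ∣ XG ∣) indep compatible))
      𝔰+k≤optIS-gadget

  𝔰-shift : ∀ {t} (G H : BGraph t) {d e} →
            (∀ S → optIS (G ⊕ gadget S) + e ≡ optIS (H ⊕ gadget S) + d) →
            ∀ S → 𝔰 G S + e ≡ 𝔰 H S + d
  𝔰-shift G H {d} {e} opt-shift S = +-cancelʳ-≡ k (𝔰 G S + e) (𝔰 H S + d) (begin
    𝔰 G S + e + k             ≡⟨ xy∙z≈xz∙y (𝔰 G S) e k ⟩
    𝔰 G S + k + e             ≡⟨ cong (_+ e) (optIS-gadget G S) ⟨
    optIS (G ⊕ gadget S) + e  ≡⟨ opt-shift S ⟩
    optIS (H ⊕ gadget S) + d  ≡⟨ cong (_+ d) (optIS-gadget H S) ⟩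
    𝔰 H S + k + d             ≡⟨ xy∙z≈xz∙y (𝔰 H S) k d ⟩
    𝔰 H S + d + k             ∎)
    where
    open ≡-Reasoning
    k : ℕ
    k = length (inner (gadget S))

open import Data.Integer using (ℤ; +_; -[1+_]; _+_)
import Data.Integer.Properties as ℤ
open import Algebra.Properties.AbelianGroup ℤ.+-0-abelianGroup using (∙-cancelʳ)
import Data.Nat as ℕ

ℤ-difference : ∀ c → ∃[ d ] ∃[ e ] c + + e ≡ + d
ℤ-difference (+ d)    = d , 0 , ℤ.+-identityʳ (+ d)
ℤ-difference -[1+ e ] = 0 , ℕ.suc e , ℤ.+-inverseˡ (+ ℕ.suc e)

+≡+-shift⇔ : ∀ c {d e} → c + + e ≡ + d → ∀ x y → (+ x ≡ + y + c) ⇔ (x ℕ.+ e ≡ y ℕ.+ d)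
+≡+-shift⇔ c {d} {e} c+e≡d x y = mk⇔
  (λ x≡y+c → ℤ.+-injective (trans (ℤ.pos-+ x e) (trans (cong (_+ + e) x≡y+c) y+c+e≡y+d)))
  (λ x+e≡y+d → ∙-cancelʳ (+ e) (+ x) (+ y + c)
    (trans (sym (ℤ.pos-+ x e)) (trans (cong +_ x+e≡y+d) (sym y+c+e≡y+d))))
  where
  y+c+e≡y+d : + y + c + + e ≡ + (y ℕ.+ d)
  y+c+e≡y+d = trans (ℤ.+-assoc (+ y) c (+ e)) (trans (cong (_+_ (+ y)) c+e≡d) (sym (ℤ.pos-+ y d)))

theorem7 : {t : ℕ} (G H : BGraph t) →
    (G ≡IS H) ⇔ (Σ[ c ∈ ℤ ] ((S : Subset t) → + 𝔰 G S ≡ + 𝔰 H S + c))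
theorem7 {t} G H = mk⇔ to from
  where
  to : G ≡IS H → Σ[ c ∈ ℤ ] ((S : Subset t) → + 𝔰 G S ≡ + 𝔰 H S + c)
  to (Δ , opt-shift) with ℤ-difference Δ
  ... | d , e , Δ+e≡d = Δ , λ S → Equivalence.from (shift _ _)
    (𝔰-shift G H (λ S → Equivalence.to (shift _ _) (opt-shift (gadget S))) S)
    where
    shift : ∀ x y → (+ x ≡ + y + Δ) ⇔ (x ℕ.+ e ≡ y ℕ.+ d)
    shift = +≡+-shift⇔ Δ Δ+e≡d

  from : Σ[ c ∈ ℤ ] ((S : Subset t) → + 𝔰 G S ≡ + 𝔰 H S + c) → G ≡IS H
  from (c , 𝔰-offset) with ℤ-difference c
  ... | d , e , c+e≡d = c , λ F → Equivalence.from (shift _ _)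
    (optIS-⊕-shift G H (λ S → Equivalence.to (shift _ _) (𝔰-offset S)) F)
    where
    shift : ∀ x y → (+ x ≡ + y + c) ⇔ (x ℕ.+ e ≡ y ℕ.+ d)
    shift = +≡+-shift⇔ c c+e≡d
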